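{- Let $\mathbb{K}$ be a field and $(B_n)_{n\ge1}$ a sequence in $\mathbb{K}$. Let $L_B$ be the $\mathbb{K}$-linear endomorphism of $\mathbb{K}[z]$ with $L_B(z^n)=B_{n+1}z^{n+1}$ for all $n\ge 0$. Let $\Delta:\mathbb{K}[z]\to\mathbb{K}[z]\otimes\mathbb{K}[z]$ be the algebra homomorphism determined by $\Delta(z)=1\otimes z+z\otimes 1$. If \[\Delta\circ L_B=(\mathrm{id}\otimes L_B)\circ\Delta+L_B\otimes 1,\] where $(L_B\otimes 1)(p)=L_B(p)\otimes 1$, then there exists $c\in\mathbb{K}$ such that $B_n=c/n$ for all $n\ge1$. -}

module Defs where

open import Level using (Level; _⊔_)
open import Algebra.Bundles using (CommutativeRing)
open import Data.Nat using (ℕ; zero; suc)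
open import Data.List using (List; []; _∷_)
open import Data.Product using (∃)
open import Relation.Nullary using (¬_)

record IsField {c ℓ : Level} (K : CommutativeRing c ℓ) : Set (c ⊔ ℓ) where
  open CommutativeRing K hiding (zero)
  field
    1≉0     : ¬ (1# ≈ 0#)
    inverse : ∀ x → ¬ (x ≈ 0#) → ∃ λ y → x * y ≈ 1#

module Poly {c ℓ : Level} (K : CommutativeRing c ℓ) where
  open CommutativeRing K hiding (zero)

  -- K[z] : polynomials as coefficient lists  a₀ ∷ a₁ ∷ …  (a₀ + a₁ z + …)
  -- the image of a natural number n in K:  n · 1 = 1 + 1 + … + 1
  fromℕ : ℕ → Carrier
  fromℕ zero    = 0#
  fromℕ (suc n) = 1# + fromℕ n

  Poly : Set c
  Poly = List Carrier

  coeff : Poly → ℕ → Carrier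
  coeff []       _       = 0#
  coeff (a ∷ p)  zero    = a
  coeff (a ∷ p)  (suc n) = coeff p n

  -- K[z] ⊗ K[z], given by coefficients: T i j is the coefficient of z^i ⊗ z^j
  -- (elements arising below are all finitely supported).
  Tensor : Set c
  Tensor = ℕ → ℕ → Carrier

  zeroT : Tensor
  zeroT _ _ = 0#

  _+T_ : Tensor → Tensor → Tensor
  (S +T T) i j = S i j + T i j

  constT : Carrier → Tensor
  constT a zero    zero    = a
  constT a _       _       = 0#

  -- multiplication by  Δ(z) = 1 ⊗ z + z ⊗ 1
  mulΔz : Tensor → Tensor
  mulΔz T zero    zero    = 0#
  mulΔz T (suc i) zero    = T i zero
  mulΔz T zero    (suc j) = T zero j
  mulΔz T (suc i) (suc j) = T i (suc j) + T (suc i) j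

  -- Δ : K[z] → K[z] ⊗ K[z], the algebra homomorphism with
  -- Δ(z) = 1 ⊗ z + z ⊗ 1, i.e. Δ(p) = p(1 ⊗ z + z ⊗ 1) (Horner evaluation)
  Δ : Poly → Tensor
  Δ []      = zeroT
  Δ (a ∷ p) = constT a +T mulΔz (Δ p)

  -- L_B : K[z] → K[z], the linear map with L_B(z^n) = B_{n+1} z^{n+1}.
  -- The sequence (B_n)_{n ≥ 1} is given as B : ℕ → K; the value B 0 is never used.
  module _ (B : ℕ → Carrier) where
    L-from : ℕ → Poly → Poly
    L-from n []      = []
    L-from n (a ∷ p) = B (suc n) * a ∷ L-from (suc n) p

    L : Poly → Poly
    L p = 0# ∷ L-from zero p

    idL : Tensor → Tensor
    idL T i zero    = 0#
    idL T i (suc j) = B (suc j) * T i j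

    L⊗1 : Poly → Tensor
    L⊗1 p i zero    = coeff (L p) i
    L⊗1 p i (suc j) = 0#

module Submission where

-- Compare the coefficients of  z^n ⊗ z  on both sides of the
-- cocycle identity  Δ ∘ L_B = (id ⊗ L_B) ∘ Δ + L_B ⊗ 1.
--   * On the left, the  (· ⊗ z)-part of Δ(q) is the derivative of q, so the
--     coefficient of z^n ⊗ z in Δ(L_B p) is  (n+1) · B_{n+1} · p_n.
--   * On the right, id ⊗ L_B sends z^n ⊗ 1 to B_1 · z^n ⊗ z, and the
--     (· ⊗ 1)-part of Δ(p) is p itself, so the coefficient is  B_1 · p_n;
--     L_B(p) ⊗ 1 contributes nothing to the second tensor degree 1.
-- Taking p = z^n (so p_n = 1) gives  (n+1) · B_{n+1} = B_1  for all n,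
-- i.e. the theorem with c = B_1.

open import Defs
open import Level using (Level)
open import Algebra.Bundles using (CommutativeRing)
open import Data.Nat using (ℕ; zero; suc; _≤_) renaming (_+_ to _+ℕ_)
open import Data.Nat.Properties using (+-suc) renaming (+-identityʳ to +-identityʳ-ℕ)
open import Data.List using ([]; _∷_)
open import Data.Product using (∃; _,_)
open import Relation.Binary.PropositionalEquality using (_≡_; refl) renaming (sym to sym≡)
import Relation.Binary.Reasoning.Setoid as SetoidReasoning

module Coefficients {c ℓ : Level} (K : CommutativeRing c ℓ) where
  open CommutativeRing K hiding (zero) renaming (refl to ≈-refl)
  open Poly K
  open SetoidReasoning setoid

  Δ-degree0 : ∀ p i → Δ p i 0 ≈ coeff p i
  Δ-degree0 []      i       = ≈-refl
  Δ-degree0 (a ∷ p) zero    = +-identityʳ a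
  Δ-degree0 (a ∷ p) (suc i) = trans (+-identityˡ _) (Δ-degree0 p i)

  Δ-degree1 : ∀ p i → Δ p i 1 ≈ fromℕ (suc i) * coeff p (suc i)
  Δ-degree1 []      i    = sym (zeroʳ _)
  Δ-degree1 (a ∷ p) zero = begin
    0# + Δ p 0 0           ≈⟨ +-identityˡ _ ⟩
    Δ p 0 0                ≈⟨ Δ-degree0 p 0 ⟩
    coeff p 0              ≈⟨ sym (*-identityˡ _) ⟩
    1# * coeff p 0         ≈⟨ *-congʳ (sym (+-identityʳ 1#)) ⟩
    (1# + 0#) * coeff p 0  ∎
  Δ-degree1 (a ∷ p) (suc i) = begin
    0# + (Δ p i 1 + Δ p (suc i) 0)  ≈⟨ +-identityˡ _ ⟩
    Δ p i 1 + Δ p (suc i) 0         ≈⟨ +-cong (Δ-degree1 p i) (Δ-degree0 p (suc i)) ⟩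
    fromℕ (suc i) * x + x           ≈⟨ +-comm _ _ ⟩
    x + fromℕ (suc i) * x           ≈⟨ +-congʳ (sym (*-identityˡ x)) ⟩
    1# * x + fromℕ (suc i) * x      ≈⟨ sym (distribʳ x 1# (fromℕ (suc i))) ⟩
    (1# + fromℕ (suc i)) * x        ∎
    where x = coeff p (suc i)

  -- L-from B k multiplies the n-th coefficient by B_{k+n+1}
  -- (the list starts at exponent k).
  coeff-L-from : ∀ (B : ℕ → Carrier) k p n →
                 coeff (L-from B k p) n ≈ B (suc (k +ℕ n)) * coeff p n
  coeff-L-from B k []      n    = sym (zeroʳ _)
  coeff-L-from B k (a ∷ p) zero rewrite +-identityʳ-ℕ k = ≈-refl
  coeff-L-from B k (a ∷ p) (suc n) rewrite +-suc k n = coeff-L-from B (suc k) p n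

  coeff-L : ∀ (B : ℕ → Carrier) p n → coeff (L B p) (suc n) ≈ B (suc n) * coeff p n
  coeff-L B p n = coeff-L-from B 0 p n

  coefficient-relation :
    ∀ (B : ℕ → Carrier) →
    (∀ p i j → Δ (L B p) i j ≈ (idL B (Δ p) +T L⊗1 B p) i j) →
    ∀ p n → fromℕ (suc n) * (B (suc n) * coeff p n) ≈ B 1 * coeff p n
  coefficient-relation B cocycle p n = begin
    fromℕ (suc n) * (B (suc n) * coeff p n)  ≈⟨ *-congˡ (sym (coeff-L B p n)) ⟩
    fromℕ (suc n) * coeff (L B p) (suc n)    ≈⟨ sym (Δ-degree1 (L B p) n) ⟩
    Δ (L B p) n 1                            ≈⟨ cocycle p n 1 ⟩
    B 1 * Δ p n 0 + 0#                       ≈⟨ +-identityʳ _ ⟩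
    B 1 * Δ p n 0                            ≈⟨ *-congˡ (Δ-degree0 p n) ⟩
    B 1 * coeff p n                          ∎

  monomial : ℕ → Poly
  monomial zero    = 1# ∷ []
  monomial (suc n) = 0# ∷ monomial n

  coeff-monomial : ∀ n → coeff (monomial n) n ≡ 1#
  coeff-monomial zero    = refl
  coeff-monomial (suc n) = coeff-monomial n

mainTheorem3 : {c ℓ : Level} (K : CommutativeRing c ℓ) → IsField K →
  let open CommutativeRing K
      open Poly K
  in (B : ℕ → Carrier) →
     (∀ (p : Poly) (i j : ℕ) → Δ (L B p) i j ≈ (idL B (Δ p) +T L⊗1 B p) i j) →
     ∃ λ (c : Carrier) → ∀ (n : ℕ) → 1 ≤ n → fromℕ n * B n ≈ c
mainTheorem3 K _ B cocycle = B 1 , nBₙ≈B₁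
  where
  open CommutativeRing K hiding (zero)
  open Poly K
  open Coefficients K
  open SetoidReasoning setoid

  nBₙ≈B₁ : ∀ n → 1 ≤ n → fromℕ n * B n ≈ B 1
  nBₙ≈B₁ (suc n) _ = begin
    fromℕ (suc n) * B (suc n)                ≈⟨ *-congˡ (sym (*-identityʳ _)) ⟩
    fromℕ (suc n) * (B (suc n) * 1#)         ≈⟨ *-congˡ (*-congˡ (reflexive (sym≡ coeff-zⁿ))) ⟩
    fromℕ (suc n) * (B (suc n) * coeff zⁿ n) ≈⟨ coefficient-relation B cocycle zⁿ n ⟩
    B 1 * coeff zⁿ n                         ≈⟨ *-congˡ (reflexive coeff-zⁿ) ⟩
    B 1 * 1#                                 ≈⟨ *-identityʳ _ ⟩
    B 1                                      ∎
    where
    zⁿ : Poly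
    zⁿ = monomial n
    coeff-zⁿ : coeff zⁿ n ≡ 1#
    coeff-zⁿ = coeff-monomial n
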